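{- Let $k\ge3$ be odd, let $H$ be a Kimura Hadamard matrix of order $n=8k+4$ and let $(R,S)\in\mathrm{Aut}(H)$ with $R$ a diagonal matrix. If there is an index $j$ such that the $j$-th column of $HS^\intercal$ equals the $j$-th column of $H$, then $(R,S)=(I_n,I_n)$.
   Context: $D_{2k}=\langle x,y\mid x^k=1,\ y^2=1,\ y^{ -1}xy=x^{ -1}\rangle$, with elements listed in the order $x^0,\dots,x^{k-1},y,xy,\dots,x^{k-1}y$, which indexes rows and columns of $2k\times2k$ matrices. $\rho(g)=[\delta_{ug,v}]_{u,v}$ is the right regular matrix representation, extended linearly to $\mathbb{Z}D_{2k}$; for $w\in\mathbb{Z}D_{2k}$ with coefficients in $\{0,1\}$ its associated $\pm1$-matrix is $2\rho(w)-J_{2k}$. A Kimura Hadamard matrix of order $8k+4$ is a matrix \[ H=\begin{bmatrix} 1& 1 & 1 & 1 & \mathbf{1} & \mathbf{1} & \mathbf{1} & \mathbf{1}\\ 1& 1 & -1 & -1 & \mathbf{1} & \mathbf{1} & -\mathbf{1} & -\mathbf{1}\\ 1& -1 & 1 & -1 & \mathbf{1} & -\mathbf{1} & \mathbf{1} & -\mathbf{1}\\ 1& -1 & -1 & 1 & -\mathbf{1} & \mathbf{1} & \mathbf{1} & -\mathbf{1}\\ \mathbf{1}^\intercal & \mathbf{1}^\intercal & \mathbf{1}^\intercal & -\mathbf{1}^\intercal & A & B& C & D\\ \mathbf{1}^\intercal & \mathbf{1}^\intercal& -\mathbf{1}^\intercal & \mathbf{1}^\intercal & -B & A & D & -C\\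 \mathbf{1}^\intercal & -\mathbf{1}^\intercal& \mathbf{1}^\intercal & \mathbf{1}^\intercal & -C & -D & A & B\\ \mathbf{1}^\intercal & -\mathbf{1}^\intercal& -\mathbf{1}^\intercal & -\mathbf{1}^\intercal & D & -C & B & -A \end{bmatrix} \] ($\mathbf 1$ the all-ones row vector of length $2k$) with $HH^\intercal=(8k+4)I_{8k+4}$, where $A,B,C,D$ are the $\pm1$-matrices associated to some $a,b,c,d\in\mathbb{Z}D_{2k}$ with coefficients in $\{0,1\}$. $\mathrm{Aut}(H)=\{(R,S): R,S\ \text{are}\ n\times n\ \text{signed permutation matrices},\ RHS^\intercal=H\}$. -}

module Defs where

open import Data.Nat as ℕ using (ℕ; zero; suc; _∸_; _<ᵇ_; _≡ᵇ_)
open import Data.Bool using (Bool; true; false; if_then_else_; _xor_)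
open import Data.Integer as ℤ using (ℤ; +_; -_; _*_; _+_; _-_)
open import Data.Fin as F using (Fin; toℕ; splitAt; remQuot)
open import Data.Fin.Permutation using (Permutation′; _⟨$⟩ʳ_)
open import Data.Fin.Properties using (_≟_)
open import Data.Product using (_×_; _,_; Σ; ∃)
open import Data.Sum using (_⊎_; inj₁; inj₂)
open import Data.Vec using (Vec; []; _∷_; lookup)
open import Relation.Nullary.Decidable using (⌊_⌋)
open import Relation.Binary.PropositionalEquality using (_≡_)

Matrix : ℕ → Set
Matrix n = Fin n → Fin n → ℤ

sumF : ∀ {m} → (Fin m → ℤ) → ℤ
sumF {zero}  f = + 0
sumF {suc m} f = f F.zero + sumF (λ i → f (F.suc i))

_·_ : ∀ {n} → Matrix n → Matrix n → Matrix n
(M · N) i j = sumF (λ l → M i l * N l j)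

_ᵀ : ∀ {n} → Matrix n → Matrix n
(M ᵀ) i j = M j i

δ : ∀ {n} → Fin n → Fin n → ℤ
δ i j = if ⌊ i ≟ j ⌋ then + 1 else + 0

Id : ∀ n → Matrix n
Id n = δ

_⊙_ : ∀ {n} → ℤ → Matrix n → Matrix n
(c ⊙ M) i j = c * M i j

_≐_ : ∀ {n} → Matrix n → Matrix n → Set
M ≐ N = ∀ i j → M i j ≡ N i j

IsSignedPerm : ∀ {n} → Matrix n → Set
IsSignedPerm {n} M =
  Σ (Permutation′ n) λ σ → Σ (Fin n → ℤ) λ ε →
    (∀ i → (ε i ≡ + 1) ⊎ (ε i ≡ - (+ 1))) ×
    (∀ i j → M i j ≡ (if ⌊ (σ ⟨$⟩ʳ i) ≟ j ⌋ then ε i else + 0))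

IsDiagonal : ∀ {n} → Matrix n → Set
IsDiagonal M = ∀ i j → ¬eq i j → M i j ≡ + 0
  where
  open import Relation.Nullary using (¬_)
  ¬eq : _ → _ → Set
  ¬eq i j = ¬ (i ≡ j)

InAut : ∀ {n} → Matrix n → Matrix n → Matrix n → Set
InAut H R S = IsSignedPerm R × IsSignedPerm S × ((R · H) · (S ᵀ)) ≐ H

-- The dihedral group D_{2k}, elements indexed by Fin (k + k):
-- index i < k  is x^i,   index k + i  is x^i y.
-- An element x^a y^e is coded as (a , e) with a < k.

Dih : Set
Dih = ℕ × Bool

dec : (k : ℕ) → ℕ → Dih
dec k i = if i <ᵇ k then (i , false) else (i ∸ k , true)

enc : (k : ℕ) → Dih → ℕ
enc k (a , e) = if e then k ℕ.+ a else a

red : (k : ℕ) → ℕ → ℕ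
red k n = if n <ᵇ k then n else n ∸ k

-- (x^a y^e)(x^b y^f) = x^(a + (-1)^e b) y^(e + f),  using y x^b = x^(-b) y
dmul : (k : ℕ) → Dih → Dih → Dih
dmul k (a , e) (b , f) = (red k (a ℕ.+ (if e then k ∸ b else b)) , e xor f)

gmul : (k : ℕ) → Fin (k ℕ.+ k) → Fin (k ℕ.+ k) → ℕ
gmul k u g = enc k (dmul k (dec k (toℕ u)) (dec k (toℕ g)))

ρ : (k : ℕ) → Fin (k ℕ.+ k) → Matrix (k ℕ.+ k)
ρ k g u v = if gmul k u g ≡ᵇ toℕ v then + 1 else + 0

-- group-ring elements with coefficients in {0,1}
GR01 : ℕ → Set
GR01 k = Fin (k ℕ.+ k) → Bool

coeff : Bool → ℤ
coeff b = if b then + 1 else + 0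

ρ* : (k : ℕ) → GR01 k → Matrix (k ℕ.+ k)
ρ* k w u v = sumF (λ g → coeff (w g) * ρ k g u v)

pm : (k : ℕ) → GR01 k → Matrix (k ℕ.+ k)
pm k w u v = + 2 * ρ* k w u v - + 1

ord : ℕ → ℕ
ord k = 4 ℕ.+ 4 ℕ.* (k ℕ.+ k)

private
  p n : ℤ
  p = + 1
  n = - (+ 1)

TL : Vec (Vec ℤ 4) 4
TL = (p ∷ p ∷ p ∷ p ∷ []) ∷ (p ∷ p ∷ n ∷ n ∷ []) ∷ (p ∷ n ∷ p ∷ n ∷ []) ∷ (p ∷ n ∷ n ∷ p ∷ []) ∷ []

-- signs of the all-ones row blocks (top-right)
TR : Vec (Vec ℤ 4) 4
TR = (p ∷ p ∷ p ∷ p ∷ []) ∷ (p ∷ p ∷ n ∷ n ∷ []) ∷ (p ∷ n ∷ p ∷ n ∷ []) ∷ (n ∷ p ∷ p ∷ n ∷ []) ∷ []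

-- signs of the all-ones column blocks (bottom-left); row = block row
BL : Vec (Vec ℤ 4) 4
BL = (p ∷ p ∷ p ∷ n ∷ []) ∷ (p ∷ p ∷ n ∷ p ∷ []) ∷ (p ∷ n ∷ p ∷ p ∷ []) ∷ (p ∷ n ∷ n ∷ n ∷ []) ∷ []

-- bottom-right: signs and which of A,B,C,D (0,1,2,3)
BRs : Vec (Vec ℤ 4) 4
BRs = (p ∷ p ∷ p ∷ p ∷ []) ∷ (n ∷ p ∷ p ∷ n ∷ []) ∷ (n ∷ n ∷ p ∷ p ∷ []) ∷ (p ∷ n ∷ p ∷ n ∷ []) ∷ []

BRw : Vec (Vec (Fin 4) 4) 4
BRw = (f0 ∷ f1 ∷ f2 ∷ f3 ∷ []) ∷ (f1 ∷ f0 ∷ f3 ∷ f2 ∷ []) ∷ (f2 ∷ f3 ∷ f0 ∷ f1 ∷ []) ∷ (f3 ∷ f2 ∷ f1 ∷ f0 ∷ []) ∷ []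
  where
  f0 f1 f2 f3 : Fin 4
  f0 = F.zero
  f1 = F.suc F.zero
  f2 = F.suc (F.suc F.zero)
  f3 = F.suc (F.suc (F.suc F.zero))

tab : ∀ {A : Set} → Vec (Vec A 4) 4 → Fin 4 → Fin 4 → A
tab T r c = lookup (lookup T r) c

kimura : (k : ℕ) → (a b c d : GR01 k) → Matrix (ord k)
kimura k a b c d i j with splitAt 4 i | splitAt 4 j
... | inj₁ r | inj₁ s = tab TL r s
... | inj₁ r | inj₂ t = tab TR r (Data.Product.proj₁ (remQuot (k ℕ.+ k) t))
... | inj₂ t | inj₁ s = tab BL (Data.Product.proj₁ (remQuot (k ℕ.+ k) t)) s
... | inj₂ t | inj₂ t′ with remQuot {4} (k ℕ.+ k) t | remQuot {4} (k ℕ.+ k) t′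
...   | (β , u) | (β′ , v) = tab BRs β β′ * pm k (lookup (a ∷ b ∷ c ∷ d ∷ []) (tab BRw β β′)) u v

IsHadamard : ∀ {m} → Matrix m → Set
IsHadamard {m} H = (H · (H ᵀ)) ≐ ((+ m) ⊙ Id m)

{-# OPTIONS --safe #-}

-- A diagonal signed permutation R is a sign matrix diag(εᴿ). Comparing R H Sᵀ = H with the
-- fixed column j₀ of H Sᵀ gives εᴿᵢ Hᵢⱼ₀ = Hᵢⱼ₀, so R = I because H has no zero entries.
-- Then H Sᵀ = H says that every column j of H is ± the column σ j. For the Gram matrix
-- G = HᵀH, H Hᵀ = N I gives G² = N G, i.e. Σₓ Gⱼₓ² = N Gⱼⱼ. If σ j ≠ j, row j of G contains
-- ±Gⱼⱼ twice, and Gⱼⱼ ≥ N since it is a sum of N nonzero squares; hence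
-- 2 Gⱼⱼ² ≤ N Gⱼⱼ ≤ Gⱼⱼ², which is absurd. So σ is the identity, all signs are +1, and S = I.
module Submission where

open import Defs

module HadamardAutomorphisms where

  import Data.Integer.Properties as ℤ
  open import Algebra.Properties.CommutativeSemigroup ℤ.*-commutativeSemigroup
    using (x∙yz≈y∙xz; interchange)
  open import Algebra.Properties.Semiring.Sum ℤ.+-*-semiring
    using (sum; sum-cong-≗; sum-replicate-zero; ∑-comm; *-distribˡ-sum; *-distribʳ-sum)
  open import Data.Bool using (if_then_else_)
  open import Data.Empty using (⊥-elim)
  open import Data.Fin using (Fin; zero; suc; splitAt; remQuot)
  open import Data.Fin.Permutation using (_⟨$⟩ʳ_)
  open import Data.Fin.Properties using (_≟_)
  open import Data.Integer using (ℤ; +_; -_; +[1+_]; -[1+_]; _+_; _*_; _-_; _≤_; +≤+; nonNegative; ≢-nonZero)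
  import Data.Nat as ℕ
  import Data.Nat.Properties as ℕ
  open import Data.Product using (_×_; _,_; proj₁; proj₂)
  open import Data.Sum using (_⊎_; inj₁; inj₂; [_,_])
  open import Data.Vec using (Vec; lookup; _∷_; [])
  import Data.Vec.Relation.Unary.All as All
  open import Data.Vec.Relation.Unary.All.Properties using (lookup⁺)
  open import Function using (_∘_)
  open import Relation.Binary.PropositionalEquality
    using (_≡_; _≢_; refl; sym; trans; cong; cong₂; subst; subst₂; ≡-≟-identity; module ≡-Reasoning)
  open import Relation.Nullary using (¬_; Dec; yes; no)
  open import Relation.Nullary.Decidable using (⌊_⌋; ⌊⌋-map′; True; toWitness; _⊎-dec_)

  open ≡-Reasoning

  sumF≡sum : ∀ {m} (f : Fin m → ℤ) → sumF f ≡ sum f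
  sumF≡sum {ℕ.zero}  f = refl
  sumF≡sum {ℕ.suc m} f = cong (_+_ (f zero)) (sumF≡sum (f ∘ suc))

  sumF-cong : ∀ {m} {f g : Fin m → ℤ} → (∀ i → f i ≡ g i) → sumF f ≡ sumF g
  sumF-cong {f = f} {g} f≗g = trans (sumF≡sum f) (trans (sum-cong-≗ f≗g) (sym (sumF≡sum g)))

  *-distribˡ-sumF : ∀ {m} c (f : Fin m → ℤ) → c * sumF f ≡ sumF (λ i → c * f i)
  *-distribˡ-sumF c f =
    trans (cong (c *_) (sumF≡sum f)) (trans (*-distribˡ-sum c f) (sym (sumF≡sum (λ i → c * f i))))

  *-distribʳ-sumF : ∀ {m} c (f : Fin m → ℤ) → sumF f * c ≡ sumF (λ i → f i * c)
  *-distribʳ-sumF c f =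
    trans (cong (_* c) (sumF≡sum f)) (trans (*-distribʳ-sum c f) (sym (sumF≡sum (λ i → f i * c))))

  sumF-comm : ∀ {m n} (f : Fin m → Fin n → ℤ) →
              sumF (λ i → sumF (f i)) ≡ sumF (λ j → sumF (λ i → f i j))
  sumF-comm f = begin
    sumF (λ i → sumF (f i))          ≡⟨ double-sumF≡sum f ⟩
    sum (λ i → sum (f i))            ≡⟨ ∑-comm f ⟩
    sum (λ j → sum (λ i → f i j))    ≡⟨ double-sumF≡sum (λ j i → f i j) ⟨
    sumF (λ j → sumF (λ i → f i j))  ∎
    where
    double-sumF≡sum : ∀ {m n} (g : Fin m → Fin n → ℤ) →
                      sumF (λ i → sumF (g i)) ≡ sum (λ i → sum (g i))
    double-sumF≡sum g = trans (sumF-cong (λ i → sumF≡sum (g i))) (sumF≡sum (λ i → sum (g i)))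

  -- Away from t the summand + 0 * f l computes to + 0, so the chains below start from the
  -- already reduced sums.
  sumF-select : ∀ {m} (t : Fin m) (e : ℤ) (f : Fin m → ℤ) →
                sumF (λ l → (if ⌊ t ≟ l ⌋ then e else + 0) * f l) ≡ e * f t
  sumF-select {ℕ.suc m} zero e f = begin
    e * f zero + sumF {m} (λ _ → + 0)
      ≡⟨ cong (_+_ (e * f zero)) (trans (sumF≡sum (λ (_ : Fin m) → + 0)) (sum-replicate-zero m)) ⟩
    e * f zero + + 0
      ≡⟨ ℤ.+-identityʳ _ ⟩
    e * f zero ∎
  sumF-select {ℕ.suc m} (suc t) e f = begin
    + 0 + sumF (λ l → (if ⌊ suc t ≟ suc l ⌋ then e else + 0) * f (suc l))
      ≡⟨ ℤ.+-identityˡ _ ⟩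
    sumF (λ l → (if ⌊ suc t ≟ suc l ⌋ then e else + 0) * f (suc l))
      ≡⟨ sumF-cong (λ l → cong (λ b → (if b then e else + 0) * f (suc l)) (⌊⌋-map′ _ _ (t ≟ l))) ⟩
    sumF (λ l → (if ⌊ t ≟ l ⌋ then e else + 0) * f (suc l))
      ≡⟨ sumF-select t e (f ∘ suc) ⟩
    e * f (suc t) ∎

  0≤i*i : ∀ i → + 0 ≤ i * i
  0≤i*i (+ ℕ.zero) = +≤+ ℕ.z≤n
  0≤i*i +[1+ n ]   = +≤+ ℕ.z≤n
  0≤i*i -[1+ n ]   = +≤+ ℕ.z≤n

  1≤i*i : ∀ {i} → i ≢ + 0 → + 1 ≤ i * i
  1≤i*i {+ ℕ.zero} i≢0 = ⊥-elim (i≢0 refl)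
  1≤i*i {+[1+ n ]} _   = +≤+ (ℕ.s≤s ℕ.z≤n)
  1≤i*i { -[1+ n ]} _  = +≤+ (ℕ.s≤s ℕ.z≤n)

  0≤sumF : ∀ {m} {f : Fin m → ℤ} → (∀ i → + 0 ≤ f i) → + 0 ≤ sumF f
  0≤sumF {ℕ.zero}  _   = +≤+ ℕ.z≤n
  0≤sumF {ℕ.suc m} 0≤f = ℤ.+-mono-≤ (0≤f zero) (0≤sumF (0≤f ∘ suc))

  term≤sumF : ∀ {m} {f : Fin m → ℤ} → (∀ i → + 0 ≤ f i) → ∀ a → f a ≤ sumF f
  term≤sumF {f = f} 0≤f zero    = ℤ.i≤i+j (f zero) _ {{nonNegative (0≤sumF (0≤f ∘ suc))}}
  term≤sumF {f = f} 0≤f (suc a) =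
    ℤ.≤-trans (term≤sumF (0≤f ∘ suc) a) (ℤ.i≤j+i _ (f zero) {{nonNegative (0≤f zero)}})

  twoTerms≤sumF : ∀ {m} {f : Fin m → ℤ} → (∀ i → + 0 ≤ f i) →
                  ∀ {a b} → a ≢ b → f a + f b ≤ sumF f
  twoTerms≤sumF         _   {zero}  {zero}  a≢b = ⊥-elim (a≢b refl)
  twoTerms≤sumF {f = f} 0≤f {zero}  {suc b} _   = ℤ.+-monoʳ-≤ (f zero) (term≤sumF (0≤f ∘ suc) b)
  twoTerms≤sumF {f = f} 0≤f {suc a} {zero}  _   =
    subst (_≤ sumF f) (ℤ.+-comm (f zero) (f (suc a))) (ℤ.+-monoʳ-≤ (f zero) (term≤sumF (0≤f ∘ suc) a))
  twoTerms≤sumF {f = f} 0≤f {suc a} {suc b} a≢b =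
    ℤ.≤-trans (twoTerms≤sumF (0≤f ∘ suc) (a≢b ∘ cong suc)) (ℤ.i≤j+i _ (f zero) {{nonNegative (0≤f zero)}})

  size≤sumF : ∀ {m} {f : Fin m → ℤ} → (∀ i → + 1 ≤ f i) → + m ≤ sumF f
  size≤sumF {ℕ.zero}  _   = +≤+ ℕ.z≤n
  size≤sumF {ℕ.suc m} 1≤f = ℤ.+-mono-≤ (1≤f zero) (size≤sumF (1≤f ∘ suc))

  ·-assoc : ∀ {n} (L M N : Matrix n) → ((L · M) · N) ≐ (L · (M · N))
  ·-assoc L M N i j = begin
    sumF (λ l → sumF (λ m → L i m * M m l) * N l j)
      ≡⟨ sumF-cong (λ l → *-distribʳ-sumF (N l j) (λ m → L i m * M m l)) ⟩
    sumF (λ l → sumF (λ m → (L i m * M m l) * N l j))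
      ≡⟨ sumF-comm (λ l m → (L i m * M m l) * N l j) ⟩
    sumF (λ m → sumF (λ l → (L i m * M m l) * N l j))
      ≡⟨ sumF-cong (λ m → sumF-cong (λ l → ℤ.*-assoc (L i m) (M m l) (N l j))) ⟩
    sumF (λ m → sumF (λ l → L i m * (M m l * N l j)))
      ≡⟨ sumF-cong (λ m → *-distribˡ-sumF (L i m) (λ l → M m l * N l j)) ⟨
    sumF (λ m → L i m * sumF (λ l → M m l * N l j))
      ∎

  ·-congˡ : ∀ {n} {L L′ : Matrix n} (M : Matrix n) → L ≐ L′ → (L · M) ≐ (L′ · M)
  ·-congˡ M L≐L′ i j = sumF-cong (λ l → cong (_* M l j) (L≐L′ i l))

  ·-congʳ : ∀ {n} (L : Matrix n) {M M′ : Matrix n} → M ≐ M′ → (L · M) ≐ (L · M′)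
  ·-congʳ L M≐M′ i j = sumF-cong (λ l → cong (L i l *_) (M≐M′ l j))

  ⊙-· : ∀ {n} c (L M : Matrix n) → ((c ⊙ L) · M) ≐ (c ⊙ (L · M))
  ⊙-· c L M i j = trans (sumF-cong (λ l → ℤ.*-assoc c (L i l) (M l j)))
                        (sym (*-distribˡ-sumF c (λ l → L i l * M l j)))

  ·-⊙ : ∀ {n} c (L M : Matrix n) → (L · (c ⊙ M)) ≐ (c ⊙ (L · M))
  ·-⊙ c L M i j = trans (sumF-cong (λ l → x∙yz≈y∙xz (L i l) c (M l j)))
                        (sym (*-distribˡ-sumF c (λ l → L i l * M l j)))

  ·-identityˡ : ∀ {n} (M : Matrix n) → (Id n · M) ≐ M
  ·-identityˡ M i j = trans (sumF-select i (+ 1) (λ l → M l j)) (ℤ.*-identityˡ (M i j))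

  gram : ∀ {n} → Matrix n → Matrix n
  gram H = (H ᵀ) · H

  gram-symmetric : ∀ {n} (H : Matrix n) i j → gram H i j ≡ gram H j i
  gram-symmetric H i j = sumF-cong (λ r → ℤ.*-comm (H r i) (H r j))

  gram-square : ∀ {N} (H : Matrix N) → IsHadamard H → (gram H · gram H) ≐ ((+ N) ⊙ gram H)
  gram-square {N} H HHᵀ≐NI i j = begin
    (((H ᵀ) · H) · ((H ᵀ) · H)) i j  ≡⟨ ·-assoc (H ᵀ) H ((H ᵀ) · H) i j ⟩
    ((H ᵀ) · (H · ((H ᵀ) · H))) i j  ≡⟨ ·-congʳ (H ᵀ) (λ r s → sym (·-assoc H (H ᵀ) H r s)) i j ⟩
    ((H ᵀ) · ((H · (H ᵀ)) · H)) i j  ≡⟨ ·-congʳ (H ᵀ) NI·H≐NH i j ⟩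
    ((H ᵀ) · ((+ N) ⊙ H)) i j        ≡⟨ ·-⊙ (+ N) (H ᵀ) H i j ⟩
    ((+ N) ⊙ ((H ᵀ) · H)) i j        ∎
    where
    NI·H≐NH : ((H · (H ᵀ)) · H) ≐ ((+ N) ⊙ H)
    NI·H≐NH r s = begin
      ((H · (H ᵀ)) · H) r s      ≡⟨ ·-congˡ H HHᵀ≐NI r s ⟩
      (((+ N) ⊙ Id N) · H) r s   ≡⟨ ⊙-· (+ N) (Id N) H r s ⟩
      + N * (Id N · H) r s       ≡⟨ cong (+ N *_) (·-identityˡ H r s) ⟩
      + N * H r s                ∎

  gram-row-squares : ∀ {N} (H : Matrix N) → IsHadamard H →
                     ∀ j → sumF (λ x → gram H j x * gram H j x) ≡ + N * gram H j j
  gram-row-squares H HHᵀ≐NI j =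
    trans (sumF-cong (λ x → cong (gram H j x *_) (gram-symmetric H j x))) (gram-square H HHᵀ≐NI j j)

  IsSign : ℤ → Set
  IsSign e = e ≡ + 1 ⊎ e ≡ - (+ 1)

  isSign? : ∀ e → Dec (IsSign e)
  isSign? e = (e ℤ.≟ + 1) ⊎-dec (e ℤ.≟ - (+ 1))

  sign≢0 : ∀ {e} → IsSign e → e ≢ + 0
  sign≢0 (inj₁ refl) ()
  sign≢0 (inj₂ refl) ()

  sign*sign≡1 : ∀ {e} → IsSign e → e * e ≡ + 1
  sign*sign≡1 (inj₁ refl) = refl
  sign*sign≡1 (inj₂ refl) = refl

  sign*≢0 : ∀ {e x} → IsSign e → x ≢ + 0 → e * x ≢ + 0
  sign*≢0 {e} e±1 x≢0 ex≡0 = [ sign≢0 e±1 , x≢0 ] (ℤ.i*j≡0⇒i≡0∨j≡0 e ex≡0)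

  x*y≡y⇒x≡1 : ∀ {x y} → y ≢ + 0 → x * y ≡ y → x ≡ + 1
  x*y≡y⇒x≡1 {x} {y} y≢0 xy≡y =
    ℤ.*-cancelʳ-≡ x (+ 1) y {{≢-nonZero y≢0}} (trans xy≡y (sym (ℤ.*-identityˡ y)))

  double-square-bound : ∀ {n c} → + 1 ≤ c → n ≤ c → ¬ (c * c + c * c ≤ n * c)
  double-square-bound {n} (+≤+ (ℕ.s≤s {n = m} _)) n≤c 2c²≤nc =
    ℕ.m+1+n≰m (ℕ.suc m) (ℤ.drop‿+≤+ (ℤ.≤-trans 2c≤n n≤c))
    where
    c = +[1+ m ]
    2c≤n : c + c ≤ n
    2c≤n = ℤ.*-cancelʳ-≤-pos (c + c) n c (subst (_≤ n * c) (sym (ℤ.*-distribʳ-+ c c c)) 2c²≤nc)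

  signed-column-unique : ∀ {N} {H : Matrix N} → IsHadamard H → (∀ i j → H i j ≢ + 0) →
                         ∀ {j l e} → IsSign e → (∀ i → e * H i l ≡ H i j) → l ≡ j × e ≡ + 1
  signed-column-unique {N} {H} HHᵀ≐NI H≢0 {j} {l} {e} e±1 eHₗ≡Hⱼ with l ≟ j
  ... | yes refl = refl , x*y≡y⇒x≡1 (H≢0 j j) (eHₗ≡Hⱼ j)
  ... | no l≢j   = ⊥-elim (double-square-bound 1≤c N≤c 2c²≤Nc)
    where
    G : Matrix N
    G = gram H

    c : ℤ
    c = G j j

    1≤c : + 1 ≤ c
    1≤c = ℤ.≤-trans (1≤i*i (H≢0 j j)) (term≤sumF (λ i → 0≤i*i (H i j)) j)

    N≤c : + N ≤ c
    N≤c = size≤sumF (λ i → 1≤i*i (H≢0 i j))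

    Hₗ≡eHⱼ : ∀ i → H i l ≡ e * H i j
    Hₗ≡eHⱼ i = begin
      H i l            ≡⟨ ℤ.*-identityˡ (H i l) ⟨
      + 1 * H i l      ≡⟨ cong (_* H i l) (sign*sign≡1 e±1) ⟨
      (e * e) * H i l  ≡⟨ ℤ.*-assoc e e (H i l) ⟩
      e * (e * H i l)  ≡⟨ cong (e *_) (eHₗ≡Hⱼ i) ⟩
      e * H i j        ∎

    Gⱼₗ≡ec : G j l ≡ e * c
    Gⱼₗ≡ec = begin
      sumF (λ i → H i j * H i l)        ≡⟨ sumF-cong (λ i → cong (H i j *_) (Hₗ≡eHⱼ i)) ⟩
      sumF (λ i → H i j * (e * H i j))  ≡⟨ sumF-cong (λ i → x∙yz≈y∙xz (H i j) e (H i j)) ⟩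
      sumF (λ i → e * (H i j * H i j))  ≡⟨ *-distribˡ-sumF e (λ i → H i j * H i j) ⟨
      e * c                             ∎

    Gⱼₗ²≡c² : G j l * G j l ≡ c * c
    Gⱼₗ²≡c² = begin
      G j l * G j l      ≡⟨ cong₂ _*_ Gⱼₗ≡ec Gⱼₗ≡ec ⟩
      (e * c) * (e * c)  ≡⟨ interchange e c e c ⟩
      (e * e) * (c * c)  ≡⟨ cong (_* (c * c)) (sign*sign≡1 e±1) ⟩
      + 1 * (c * c)      ≡⟨ ℤ.*-identityˡ (c * c) ⟩
      c * c              ∎

    2c²≤Nc : c * c + c * c ≤ + N * c
    2c²≤Nc = subst₂ _≤_ (cong (_+_ (c * c)) Gⱼₗ²≡c²) (gram-row-squares H HHᵀ≐NI j)
                        (twoTerms≤sumF (λ x → 0≤i*i (G j x)) (l≢j ∘ sym))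

  Monomial : ∀ {n} → Matrix n → (Fin n → Fin n) → (Fin n → ℤ) → Set
  Monomial P π ε = ∀ i j → P i j ≡ (if ⌊ π i ≟ j ⌋ then ε i else + 0)

  module _ {n} {P : Matrix n} {π : Fin n → Fin n} {ε : Fin n → ℤ} (P≡ : Monomial P π ε) where

    monomial-· : ∀ X i j → (P · X) i j ≡ ε i * X (π i) j
    monomial-· X i j =
      trans (sumF-cong (λ l → cong (_* X l j) (P≡ i l))) (sumF-select (π i) (ε i) (λ l → X l j))

    ·-monomialᵀ : ∀ X i j → (X · (P ᵀ)) i j ≡ ε j * X i (π j)
    ·-monomialᵀ X i j =
      trans (sumF-cong (λ l → trans (ℤ.*-comm (X i l) (P j l)) (cong (_* X i l) (P≡ j l))))
            (sumF-select (π j) (ε j) (X i))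

    monomial-diagonal : IsDiagonal P → (∀ i → ε i ≢ + 0) → ∀ i → π i ≡ i
    monomial-diagonal P-diag ε≢0 i with π i ≟ i
    ... | yes πi≡i = πi≡i
    ... | no  πi≢i = ⊥-elim (ε≢0 i (begin
      ε i                                   ≡⟨ cong (λ d → if ⌊ d ⌋ then ε i else + 0) (≡-≟-identity _≟_ refl) ⟨
      (if ⌊ π i ≟ π i ⌋ then ε i else + 0)  ≡⟨ P≡ i (π i) ⟨
      P i (π i)                             ≡⟨ P-diag i (π i) (πi≢i ∘ sym) ⟩
      + 0                                   ∎))

    monomial≐Id : (∀ i → π i ≡ i) → (∀ i → ε i ≡ + 1) → P ≐ Id n
    monomial≐Id π≗id ε≗1 i j =
      trans (P≡ i j) (cong₂ (λ x e → if ⌊ x ≟ j ⌋ then e else + 0) (π≗id i) (ε≗1 i))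

  automorphism-fixing-column-trivial :
    ∀ {N} {H R S : Matrix N} → IsHadamard H → (∀ i j → H i j ≢ + 0) →
    InAut H R S → IsDiagonal R →
    ∀ j₀ → (∀ i → (H · (S ᵀ)) i j₀ ≡ H i j₀) → (R ≐ Id N) × (S ≐ Id N)
  automorphism-fixing-column-trivial {N} {H} {R} {S} HHᵀ≐NI H≢0
      ((πR , εR , εR±1 , R≡) , (πS , εS , εS±1 , S≡) , RHSᵀ≐H) R-diag j₀ j₀-fixed =
    monomial≐Id {π = σR} R≡ σR≗id εR≗1 ,
    monomial≐Id {π = σ} S≡ (proj₁ ∘ S-trivial) (proj₂ ∘ S-trivial)
    where
    σR σ : Fin N → Fin N
    σR = πR ⟨$⟩ʳ_
    σ  = πS ⟨$⟩ʳ_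

    σR≗id : ∀ i → σR i ≡ i
    σR≗id = monomial-diagonal {π = σR} R≡ R-diag (sign≢0 ∘ εR±1)

    RHSᵀ≡ : ∀ i j → εS j * (εR i * H i (σ j)) ≡ H i j
    RHSᵀ≡ i j = begin
      εS j * (εR i * H i (σ j))       ≡⟨ cong (λ r → εS j * (εR i * H r (σ j))) (σR≗id i) ⟨
      εS j * (εR i * H (σR i) (σ j))  ≡⟨ cong (εS j *_) (monomial-· {π = σR} R≡ H i (σ j)) ⟨
      εS j * (R · H) i (σ j)          ≡⟨ ·-monomialᵀ {π = σ} S≡ (R · H) i j ⟨
      ((R · H) · (S ᵀ)) i j           ≡⟨ RHSᵀ≐H i j ⟩
      H i j                           ∎

    εR≗1 : ∀ i → εR i ≡ + 1
    εR≗1 i = x*y≡y⇒x≡1 (H≢0 i j₀) (begin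
      εR i * H i j₀                ≡⟨ cong (εR i *_) (trans (sym (j₀-fixed i)) (·-monomialᵀ {π = σ} S≡ H i j₀)) ⟩
      εR i * (εS j₀ * H i (σ j₀))  ≡⟨ x∙yz≈y∙xz (εR i) (εS j₀) (H i (σ j₀)) ⟩
      εS j₀ * (εR i * H i (σ j₀))  ≡⟨ RHSᵀ≡ i j₀ ⟩
      H i j₀                       ∎)

    HSᵀ≡ : ∀ j i → εS j * H i (σ j) ≡ H i j
    HSᵀ≡ j i = begin
      εS j * H i (σ j)           ≡⟨ cong (εS j *_) (ℤ.*-identityˡ (H i (σ j))) ⟨
      εS j * (+ 1 * H i (σ j))   ≡⟨ cong (λ e → εS j * (e * H i (σ j))) (εR≗1 i) ⟨
      εS j * (εR i * H i (σ j))  ≡⟨ RHSᵀ≡ i j ⟩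
      H i j                      ∎

    S-trivial : ∀ j → σ j ≡ j × εS j ≡ + 1
    S-trivial j = signed-column-unique HHᵀ≐NI H≢0 (εS±1 j) (HSᵀ≡ j)

  sign-table : (T : Vec (Vec ℤ 4) 4) → {True (All.all? (All.all? isSign?) T)} →
               ∀ r s → IsSign (tab T r s)
  sign-table T {signs} r s = lookup⁺ (lookup⁺ (toWitness signs) r) s

  2i-1≢0 : ∀ i → + 2 * i - + 1 ≢ + 0
  2i-1≢0 (+ ℕ.zero) ()
  2i-1≢0 +[1+ n ]   eq = ℕ.m+1+n≢0 n (ℤ.+-injective eq)
  2i-1≢0 -[1+ n ]   ()

  pm≢0 : ∀ k w u v → pm k w u v ≢ + 0
  pm≢0 k w u v = 2i-1≢0 (ρ* k w u v)

  block : ∀ k → Fin (4 ℕ.* (k ℕ.+ k)) → Fin 4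
  block k t = proj₁ (remQuot {4} (k ℕ.+ k) t)

  offset : ∀ k → Fin (4 ℕ.* (k ℕ.+ k)) → Fin (k ℕ.+ k)
  offset k t = proj₂ (remQuot {4} (k ℕ.+ k) t)

  kimura-entry≢0 : ∀ k a b c d i j → kimura k a b c d i j ≢ + 0
  kimura-entry≢0 k a b c d i j with splitAt 4 i | splitAt 4 j
  ... | inj₁ r | inj₁ s  = sign≢0 (sign-table TL r s)
  ... | inj₁ r | inj₂ t  = sign≢0 (sign-table TR r (block k t))
  ... | inj₂ t | inj₁ s  = sign≢0 (sign-table BL (block k t) s)
  ... | inj₂ t | inj₂ t′ =
    sign*≢0 (sign-table BRs (block k t) (block k t′))
            (pm≢0 k (lookup (a ∷ b ∷ c ∷ d ∷ []) (tab BRw (block k t) (block k t′)))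
                    (offset k t) (offset k t′))

open HadamardAutomorphisms using (automorphism-fixing-column-trivial; kimura-entry≢0)

open import Data.Nat using (ℕ; _≤_; _+_; _*_)
open import Data.Fin using (Fin)
open import Data.Product using (_×_; ∃; _,_)
open import Relation.Binary.PropositionalEquality using (_≡_)

proposition3p10 :
    (k : ℕ) → 3 ≤ k → ∃ (λ m → k ≡ 2 * m + 1) →
    (a b c d : GR01 k) →
    IsHadamard (kimura k a b c d) →
    (R S : Matrix (ord k)) →
    InAut (kimura k a b c d) R S →
    IsDiagonal R →
    ∃ (λ (j : Fin (ord k)) → ∀ i → (kimura k a b c d · (S ᵀ)) i j ≡ kimura k a b c d i j) →
    (R ≐ Id (ord k)) × (S ≐ Id (ord k))
proposition3p10 k _ _ a b c d hadamard R S aut R-diagonal (j , column-fixed) =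
  automorphism-fixing-column-trivial hadamard (kimura-entry≢0 k a b c d) aut R-diagonal j column-fixed
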